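{- Let $m=2^\theta\mu$ with $\mu$ odd and $\theta\ge0$. Then $A(m)$ is isomorphic to the disjoint union, over all periodic orbits (cycles) of the map $x\mapsto 2x\bmod\mu$ on $\{0,\dots,\mu-1\}$, of the flower cycle $C_\alpha(T_2^\theta)$, where $\alpha$ is the length of the orbit. That is, $A(m)$ is obtained from $A(\mu)$ by replacing every cycle of length $\alpha$ with a copy of $C_\alpha(T_2^\theta)$.
   Context: $A(m)$ is the directed graph on $\{0,\dots,m-1\}$ with an edge $x\to(2x\bmod m)$ for each $x$. A grounded tree is a finite directed graph with a distinguished root $r$ having a loop $r\to r$, such that every other vertex has exactly one outgoing edge, the underlying undirected graph minus the loop is a tree, and every vertex has a directed path to $r$. For $w>1$, $\ell>0$, $T_w^\ell$ is the grounded tree with $w^\ell$ vertices in layers $0,\dots,\ell$: layer $0$ is the root (with loop); layer $1$ has $w-1$ vertices each with an edge to the root; for $1\le j<\ell$ every vertex in layer $j$ has exactly $w$ vertices of layer $j+1$ with edges to it; no other edges. By convention $T_w^0$ is a single vertex with a loop. For a grounded tree $T$ and $\alpha\ge1$, $C_\alpha(T)$ is obtained from $\alpha$ disjoint copies $T_1,\dots,T_\alpha$ of $T$ by removing the loop at each root and adding an edge from the root of $T_i$ to the root of $T_{i+1}$, indices mod $\alpha$. -}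

module Defs where

open import Data.Nat using (ℕ; zero; suc; _*_; _≤_; _<_; NonZero; pred)
open import Data.Nat.DivMod using (_%_; m%n<n)
open import Data.Fin using (Fin; toℕ; fromℕ<; _≟_)
open import Data.Fin as Fin using ()
open import Data.Maybe using (Maybe; just; nothing)
open import Data.Product using (Σ; _×_; _,_)
open import Data.Irrelevant using (Irrelevant)
open import Relation.Nullary using (Dec; yes; no; ¬_)
open import Relation.Binary.PropositionalEquality using (_≡_; refl)
open import Function.Bundles using (_↔_; Inverse)

-- Directed graphs in which every vertex has exactly one outgoing edge
-- (functional graphs).  All graphs in the statement are of this kind:
-- A(m), the grounded trees T_w^ℓ (root has its loop) and C_α(T).

record FunGraph : Set₁ where
  field
    V    : Set
    next : V → V

  Edge : V → V → Set
  Edge x y = next x ≡ y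

open FunGraph public

_≅_ : FunGraph → FunGraph → Set
G ≅ H = Σ (V G ↔ V H) λ φ →
  ∀ x y → (Edge G x y → Edge H (Inverse.to φ x) (Inverse.to φ y))
        × (Edge H (Inverse.to φ x) (Inverse.to φ y) → Edge G x y)

dbl : (m : ℕ) → Fin m → Fin m
dbl zero    ()
dbl (suc n) x = fromℕ< (m%n<n (2 * toℕ x) (suc n))

A : ℕ → FunGraph
A m = record { V = Fin m ; next = dbl m }

-- Grounded trees (rooted functional graphs; the root carries the loop).

record GroundedTree : Set₁ where
  field
    graph   : FunGraph
    root    : V graph
    isRoot? : (v : V graph) → Dec (v ≡ root)

open GroundedTree public

-- Non-root vertices of T_w^ℓ.  A vertex of layer 1 is  top a  with
-- a : Fin (w - 1); a vertex of layer j+1 ≥ 2 is  child i v  where v is its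
-- parent (a non-root vertex of layer j of T_w^(ℓ-1)) and i : Fin w numbers
-- the w children of v.
data Below (w : ℕ) : ℕ → Set where
  top   : ∀ {ℓ} → Fin (pred w) → Below w (suc ℓ)
  child : ∀ {ℓ} → Fin w → Below w ℓ → Below w (suc ℓ)

embed : ∀ {w ℓ} → Below w ℓ → Below w (suc ℓ)
embed (top a)     = top a
embed (child i v) = child i (embed v)

-- parent map; nothing = the root
parentT : ∀ {w ℓ} → Maybe (Below w ℓ) → Maybe (Below w ℓ)
parentT nothing            = nothing
parentT (just (top a))     = nothing
parentT (just (child i v)) = just (embed v)

isNothing? : ∀ {B : Set} (v : Maybe B) → Dec (v ≡ nothing)
isNothing? nothing  = yes refl
isNothing? (just _) = no λ ()

-- The grounded tree T_w^ℓ (w^ℓ vertices; T_w^0 is a single looped vertex).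
Tree : (w ℓ : ℕ) → GroundedTree
Tree w ℓ = record
  { graph   = record { V = Maybe (Below w ℓ) ; next = parentT }
  ; root    = nothing
  ; isRoot? = isNothing?
  }

sucMod : ∀ {α} → Fin α → Fin α
sucMod {suc n} i = fromℕ< (m%n<n (suc (toℕ i)) (suc n))

C : (α : ℕ) → GroundedTree → FunGraph
C α T = record
  { V    = Fin α × V (graph T)
  ; next = step
  }
  where
  step : Fin α × V (graph T) → Fin α × V (graph T)
  step (i , v) with isRoot? T v
  ... | yes _ = (sucMod i , root T)
  ... | no  _ = (i , next (graph T) v)

iter : ∀ {X : Set} → (X → X) → ℕ → X → X
iter f zero    x = x
iter f (suc k) x = f (iter f k x)

-- x lies on a cycle of f and is the least element of its orbit;
-- such x are in bijection with the cycles of f.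
IsCycleRep : ∀ {μ} → (Fin μ → Fin μ) → Fin μ → Set
IsCycleRep f x = (Σ ℕ λ k → iter f (suc k) x ≡ x)
               × (∀ k → toℕ x ≤ toℕ (iter f k x))

-- The set of cycles of f, each represented by its least element
-- (the proof part is irrelevant, so each cycle occurs exactly once).
Cycle : ∀ {μ} → (Fin μ → Fin μ) → Set
Cycle {μ} f = Σ (Fin μ) λ x → Irrelevant (IsCycleRep f x)

IsLength : ∀ {X : Set} → (X → X) → X → ℕ → Set
IsLength f x α = (1 ≤ α) × (iter f α x ≡ x)
               × (∀ k → 1 ≤ k → k < α → ¬ (iter f k x ≡ x))

⨆ : (I : Set) → (I → FunGraph) → FunGraph
⨆ I G = record
  { V    = Σ I λ i → V (G i)
  ; next = λ { (i , v) → (i , next (G i) v) }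
  }

{-# OPTIONS --safe #-}
-- Writing a residue mod 2m as b·m + z with b ∈ {0,1}, doubling mod 2m becomes
-- (b , z) ↦ (carry z , 2z mod m), where the carry records whether 2z overflows m: A(2m) is a
-- two-sheeted cover of A(m) whose edges change sheet according to the carry. For odd μ doubling
-- permutes ℤ/μ, and the forest F_ℓ obtained by hanging a copy of T_2^ℓ on every point of A(μ)
-- (the roots following the permutation) obeys the same recursion: F_(ℓ+1) is the two-sheeted cover
-- of F_ℓ along a labelling of F_ℓ that predicts the carry. Hence A(2^ℓ μ) ≅ F_ℓ by induction, and
-- grouping the points of A(μ) by their cycles turns F_θ into the flower cycles C_α(T_2^θ).
module Submission where

open import Defs
open import Data.Nat using (ℕ; zero; suc; _+_; _*_; _∸_; _^_; _≤_; _<_; _≤?_; _<?_; z≤n; s≤s)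
open import Data.Nat.Properties
  using ( *-assoc; *-cancelʳ-≡; *-cancelˡ-≡; *-comm; *-identityˡ; *-monoʳ-<; +-cancelʳ-≡; +-comm
        ; +-identityʳ; +-suc; <-cmp; <⇒≤; m<n⇒0<n∸m; m∸n≤m; m≤n⇒m<n∨m≡n; m≤n⇒m≤1+n; n<1+n
        ; ≤-<-trans; ≤-antisym; ≤-pred; ≤-refl; ≤-trans; ∸-monoˡ-<; m∸n+n≡m; m+[n∸m]≡n; m+n∸m≡n
        ; ≰⇒>; ≮⇒≥ )
open import Data.Nat.DivMod using (_%_; _/_; m%n<n; m<n⇒m%n≡m; m≤n⇒[n∸m]%m≡n%m; [m+kn]%n≡m%n; m≡m%n+[m/n]*n)
open import Data.Nat.Divisibility using (_∣_; ∣m+n∣m⇒∣n; m∣m*n)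
open import Data.Nat.Solver using (module +-*-Solver)
open import Data.Fin using (Fin; zero; suc; toℕ; fromℕ<; combine; remQuot; opposite; _≟_)
open import Data.Fin.Properties
  using (toℕ-fromℕ<; toℕ-injective; toℕ<n; toℕ-combine; remQuot-combine; combine-remQuot; pigeonhole)
open import Data.Maybe using (Maybe; just; nothing)
open import Data.Product using (Σ; _×_; _,_; proj₁; proj₂; uncurry)
open import Data.Sum using (inj₁; inj₂)
open import Data.Irrelevant using ([_])
open import Function.Bundles using (mk↔ₛ′)
open import Relation.Binary.Definitions using (tri<; tri≈; tri>)
open import Relation.Nullary using (yes; no; ¬_; contradiction)
open import Relation.Nullary.Decidable using (recompute)
open import Relation.Binary.PropositionalEquality

record Conjugacy {X Y : Set} (f : X → X) (g : Y → Y) : Set where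
  field
    to       : X → Y
    from     : Y → X
    to∘from  : ∀ y → to (from y) ≡ y
    from∘to  : ∀ x → from (to x) ≡ x
    commutes : ∀ x → to (f x) ≡ g (to x)

open Conjugacy

conj-trans : ∀ {X Y Z : Set} {f : X → X} {g : Y → Y} {h : Z → Z} →
             Conjugacy f g → Conjugacy g h → Conjugacy f h
conj-trans I J = record
  { to       = λ x → to J (to I x)
  ; from     = λ z → from I (from J z)
  ; to∘from  = λ z → trans (cong (to J) (to∘from I (from J z))) (to∘from J z)
  ; from∘to  = λ x → trans (cong (from I) (from∘to J (to I x))) (from∘to I x)
  ; commutes = λ x → trans (cong (to J) (commutes I x)) (commutes J (to I x))
  }

conj-sym : ∀ {X Y : Set} {f : X → X} {g : Y → Y} → Conjugacy f g → Conjugacy g f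
conj-sym {f = f} {g} I = record
  { to       = from I
  ; from     = to I
  ; to∘from  = from∘to I
  ; from∘to  = to∘from I
  ; commutes = λ y → begin
      from I (g y)                 ≡⟨ cong (λ z → from I (g z)) (sym (to∘from I y)) ⟩
      from I (g (to I (from I y))) ≡⟨ cong (from I) (sym (commutes I (from I y))) ⟩
      from I (to I (f (from I y))) ≡⟨ from∘to I _ ⟩
      f (from I y)                 ∎
  }
  where open ≡-Reasoning

conjugacy⇒≅ : ∀ {G H : FunGraph} → Conjugacy (next G) (next H) → G ≅ H
conjugacy⇒≅ I = mk↔ₛ′ (to I) (from I) (to∘from I) (from∘to I) , λ x y →
    (λ e → trans (sym (commutes I x)) (cong (to I) e))
  , (λ e → trans (sym (from∘to I _)) (trans (cong (from I) (trans (commutes I x) e)) (from∘to I y)))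

record LabelledConjugacy {L X Y : Set} (f : X → X) (a : X → L) (g : Y → Y) (b : Y → L) : Set where
  field
    conjugacy : Conjugacy f g
    relabels  : ∀ x → b (to conjugacy x) ≡ a x

open LabelledConjugacy

lconj-trans : ∀ {L X Y Z : Set} {f : X → X} {g : Y → Y} {h : Z → Z}
                {a : X → L} {b : Y → L} {c : Z → L} →
              LabelledConjugacy f a g b → LabelledConjugacy g b h c → LabelledConjugacy f a h c
lconj-trans I J = record
  { conjugacy = conj-trans (conjugacy I) (conjugacy J)
  ; relabels  = λ x → trans (relabels J (to (conjugacy I) x)) (relabels I x)
  }

skew : {L Y : Set} → (Y → L) → (Y → Y) → L × Y → L × Y
skew a h (_ , y) = (a y , h y)

skew-cong : ∀ {L X Y : Set} {f : X → X} {g : Y → Y} {a : X → L} {b : Y → L} →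
            LabelledConjugacy f a g b → LabelledConjugacy (skew a f) proj₁ (skew b g) proj₁
skew-cong I = record
  { conjugacy = record
    { to       = λ { (l , x) → (l , to I₀ x) }
    ; from     = λ { (l , y) → (l , from I₀ y) }
    ; to∘from  = λ { (l , y) → cong (l ,_) (to∘from I₀ y) }
    ; from∘to  = λ { (l , x) → cong (l ,_) (from∘to I₀ x) }
    ; commutes = λ { (l , x) → cong₂ _,_ (sym (relabels I x)) (commutes I₀ x) }
    }
  ; relabels  = λ _ → refl
  }
  where I₀ = conjugacy I

reduce : ∀ {a} → 1 ≤ a → ℕ → Fin a
reduce {suc a} _ k = fromℕ< (m%n<n k (suc a))

module _ {X : Set} (f : X → X) where

  iter-+ : ∀ a b x → iter f (a + b) x ≡ iter f a (iter f b x)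
  iter-+ zero    b x = refl
  iter-+ (suc a) b x = cong f (iter-+ a b x)

  iter-comm : ∀ a b x → iter f a (iter f b x) ≡ iter f b (iter f a x)
  iter-comm a b x = trans (sym (iter-+ a b x)) (trans (cong (λ k → iter f k x) (+-comm a b)) (iter-+ b a x))

  iter-injective : (∀ {x y} → f x ≡ f y → x ≡ y) → ∀ a {x y} → iter f a x ≡ iter f a y → x ≡ y
  iter-injective inj zero    e = e
  iter-injective inj (suc a) e = iter-injective inj a (inj e)

  iter-periodic-* : ∀ {P x} → iter f P x ≡ x → ∀ q → iter f (q * P) x ≡ x
  iter-periodic-* e zero    = refl
  iter-periodic-* {P} {x} e (suc q) = trans (iter-+ P (q * P) x) (trans (cong (iter f P) (iter-periodic-* e q)) e)

  iter-periodic-% : ∀ {P x} → iter f (suc P) x ≡ x → ∀ k → iter f (k % suc P) x ≡ iter f k x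
  iter-periodic-% {P} {x} e k = sym (begin
    iter f k x                                          ≡⟨ cong (λ j → iter f j x) (m≡m%n+[m/n]*n k (suc P)) ⟩
    iter f (k % suc P + k / suc P * suc P) x            ≡⟨ iter-+ (k % suc P) _ x ⟩
    iter f (k % suc P) (iter f (k / suc P * suc P) x)   ≡⟨ cong (iter f (k % suc P)) (iter-periodic-* e (k / suc P)) ⟩
    iter f (k % suc P) x                                ∎)
    where open ≡-Reasoning

  iter-reduce : ∀ {a x} (a≥1 : 1 ≤ a) → iter f a x ≡ x →
                ∀ k → iter f (toℕ (reduce a≥1 k)) x ≡ iter f k x
  iter-reduce {suc a} {x} _ e k =
    trans (cong (λ j → iter f j x) (toℕ-fromℕ< (m%n<n k (suc a)))) (iter-periodic-% {a} e k)

  iter-sucMod : ∀ {a x} → iter f a x ≡ x → (i : Fin a) → iter f (toℕ (sucMod i)) x ≡ f (iter f (toℕ i) x)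
  iter-sucMod {suc a} e i = iter-reduce {suc a} (s≤s z≤n) e (suc (toℕ i))

argmin : (ℕ → ℕ) → ℕ → ℕ
argmin g zero = zero
argmin g (suc k) with g (suc k) <? g (argmin g k)
... | yes _ = suc k
... | no  _ = argmin g k

argmin-≤ : ∀ (g : ℕ → ℕ) k → argmin g k ≤ k
argmin-≤ g zero = z≤n
argmin-≤ g (suc k) with g (suc k) <? g (argmin g k)
... | yes _ = ≤-refl
... | no  _ = m≤n⇒m≤1+n (argmin-≤ g k)

argmin-minimal : ∀ (g : ℕ → ℕ) k j → j ≤ k → g (argmin g k) ≤ g j
argmin-minimal g zero _ z≤n = ≤-refl
argmin-minimal g (suc k) j j≤1+k with g (suc k) <? g (argmin g k) | m≤n⇒m<n∨m≡n j≤1+k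
... | yes p | inj₁ j<1+k = ≤-trans (<⇒≤ p) (argmin-minimal g k j (≤-pred j<1+k))
... | yes _ | inj₂ refl  = ≤-refl
... | no  _ | inj₁ j<1+k = argmin-minimal g k j (≤-pred j<1+k)
... | no  p | inj₂ refl  = ≮⇒≥ p

module Permutation {n : ℕ} (f : Fin n → Fin n) (f-injective : ∀ {x y} → f x ≡ f y → x ≡ y) where

  returns : ∀ u → Σ ℕ λ p → iter f (suc p) u ≡ u
  returns u with pigeonhole (n<1+n n) (λ k → iter f (toℕ k) u)
  ... | i , j , i<j , e = p , sym (iter-injective f f-injective (toℕ i) (trans e (begin
      iter f (toℕ j) u                            ≡⟨ cong (λ k → iter f k u) (sym i+p≡j) ⟩
      iter f (toℕ i + suc p) u                    ≡⟨ iter-+ f (toℕ i) (suc p) u ⟩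
      iter f (toℕ i) (iter f (suc p) u)           ∎)))
    where
    open ≡-Reasoning
    p = toℕ j ∸ suc (toℕ i)
    i+p≡j : toℕ i + suc p ≡ toℕ j
    i+p≡j = trans (+-suc (toℕ i) p) (m+[n∸m]≡n i<j)

  period : Fin n → ℕ
  period u = suc (proj₁ (returns u))

  iter-period : ∀ u → iter f (period u) u ≡ u
  iter-period u = proj₂ (returns u)

  f⁻¹ : Fin n → Fin n
  f⁻¹ u = iter f (proj₁ (returns u)) u

  f∘f⁻¹ : ∀ u → f (f⁻¹ u) ≡ u
  f∘f⁻¹ = iter-period

  f⁻¹∘f : ∀ u → f⁻¹ (f u) ≡ u
  f⁻¹∘f u = f-injective (f∘f⁻¹ (f u))

  minIndex : Fin n → ℕ
  minIndex u = argmin (λ k → toℕ (iter f k u)) (period u)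

  minIndex≤period : ∀ u → minIndex u ≤ period u
  minIndex≤period u = argmin-≤ (λ k → toℕ (iter f k u)) (period u)

  representative : Fin n → Fin n
  representative u = iter f (minIndex u) u

  representative-minimal : ∀ u k → toℕ (representative u) ≤ toℕ (iter f k u)
  representative-minimal u k =
    subst (λ v → toℕ (representative u) ≤ toℕ v) (iter-periodic-% f (iter-period u) k)
      (argmin-minimal (λ k → toℕ (iter f k u)) (period u) (k % period u) (<⇒≤ (m%n<n k (period u))))

  representative-isCycleRep : ∀ u → IsCycleRep f (representative u)
  representative-isCycleRep u = (proj₁ (returns u) , periodic) , minimal
    where
    periodic : iter f (period u) (representative u) ≡ representative u
    periodic = trans (iter-comm f (period u) (minIndex u) u) (cong (iter f (minIndex u)) (iter-period u))
    minimal : ∀ k → toℕ (representative u) ≤ toℕ (iter f k (representative u))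
    minimal k = subst (λ v → toℕ (representative u) ≤ toℕ v) (iter-+ f k (minIndex u) u)
                  (representative-minimal u (k + minIndex u))

  cycleOf : Fin n → Cycle f
  cycleOf u = representative u , [ representative-isCycleRep u ]

  representative-unique : ∀ {x P a} → .(IsCycleRep f x) → iter f P x ≡ x → a ≤ P →
                          representative (iter f a x) ≡ x
  representative-unique {x} {P} {a} isRep e a≤P = toℕ-injective (≤-antisym rep≤x x≤rep)
    where
    u = iter f a x
    returns-to-x : iter f (P ∸ a) u ≡ x
    returns-to-x = trans (sym (iter-+ f (P ∸ a) a x)) (trans (cong (λ k → iter f k x) (m∸n+n≡m a≤P)) e)
    rep≤x : toℕ (representative u) ≤ toℕ x
    rep≤x = subst (λ v → toℕ (representative u) ≤ toℕ v) returns-to-x (representative-minimal u (P ∸ a))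
    x≤rep : toℕ x ≤ toℕ (representative u)
    x≤rep = subst (λ v → toℕ x ≤ toℕ v) (iter-+ f (minIndex u) a x)
              (recompute (toℕ x ≤? _) (proj₂ isRep (minIndex u + a)))

rotate : {I : Set} (α : I → ℕ) → Σ I (λ c → Fin (α c)) → Σ I (λ c → Fin (α c))
rotate α (c , i) = (c , sucMod i)

module _ {X : Set} (f : X → X) (f-injective : ∀ {x y} → f x ≡ f y → x ≡ y)
         {x : X} {a : ℕ} (length : IsLength f x a) where

  iter-distinct : ∀ {i j} → i < j → j < a → iter f i x ≢ iter f j x
  iter-distinct {i} {j} i<j j<a e = proj₂ (proj₂ length) (j ∸ i) (m<n⇒0<n∸m i<j) (≤-<-trans (m∸n≤m j i) j<a)
    (sym (iter-injective f f-injective i (begin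
      iter f i x                  ≡⟨ e ⟩
      iter f j x                  ≡⟨ cong (λ k → iter f k x) (sym (m+[n∸m]≡n (<⇒≤ i<j))) ⟩
      iter f (i + (j ∸ i)) x      ≡⟨ iter-+ f i (j ∸ i) x ⟩
      iter f i (iter f (j ∸ i) x) ∎)))
    where open ≡-Reasoning

  iter-index-unique : ∀ {i j} → i < a → j < a → iter f i x ≡ iter f j x → i ≡ j
  iter-index-unique {i} {j} i<a j<a e with <-cmp i j
  ... | tri< i<j _ _ = contradiction e (iter-distinct i<j j<a)
  ... | tri≈ _ i≡j _ = i≡j
  ... | tri> _ _ j<i = contradiction (sym e) (iter-distinct j<i i<a)

module CycleDecomposition {n : ℕ} (f : Fin n → Fin n) (f-injective : ∀ {x y} → f x ≡ f y → x ≡ y)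
                          (α : Cycle f → ℕ) (lengths : ∀ c → IsLength f (proj₁ c) (α c)) where

  open Permutation f f-injective

  Point : Set
  Point = Σ (Cycle f) λ c → Fin (α c)

  recompose : Point → Fin n
  recompose (c , i) = iter f (toℕ i) (proj₁ c)

  offset : Fin n → ℕ
  offset u = period u ∸ minIndex u

  iter-offset : ∀ u → iter f (offset u) (representative u) ≡ u
  iter-offset u = begin
    iter f (offset u) (iter f (minIndex u) u) ≡⟨ sym (iter-+ f (offset u) (minIndex u) u) ⟩
    iter f (offset u + minIndex u) u          ≡⟨ cong (λ k → iter f k u) (m∸n+n≡m (minIndex≤period u)) ⟩
    iter f (period u) u                       ≡⟨ iter-period u ⟩
    u                                         ∎
    where open ≡-Reasoning

  decompose : Fin n → Point
  decompose u = cycleOf u , reduce (proj₁ (lengths (cycleOf u))) (offset u)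

  recompose∘decompose : ∀ u → recompose (decompose u) ≡ u
  recompose∘decompose u =
    trans (iter-reduce f (proj₁ (lengths c)) (proj₁ (proj₂ (lengths c))) (offset u)) (iter-offset u)
    where c = cycleOf u

  Point-≡ : ∀ {c d} → c ≡ d → (i : Fin (α c)) (j : Fin (α d)) →
            iter f (toℕ i) (proj₁ c) ≡ iter f (toℕ j) (proj₁ d) → _≡_ {A = Point} (c , i) (d , j)
  Point-≡ {c} refl i j e = cong (c ,_) (toℕ-injective
    (iter-index-unique f f-injective (lengths c) (toℕ<n i) (toℕ<n j) e))

  Cycle-≡ : {c d : Cycle f} → proj₁ c ≡ proj₁ d → c ≡ d
  Cycle-≡ refl = refl

  decompose-unique : ∀ p u → recompose p ≡ u → decompose u ≡ p
  decompose-unique ((x , [ isRep ]) , i) u e =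
    Point-≡ same-cycle _ i (trans (recompose∘decompose u) (sym e))
    where
    same-cycle : cycleOf u ≡ (x , [ isRep ])
    same-cycle = Cycle-≡ (trans (cong representative (sym e))
      (representative-unique isRep (proj₁ (proj₂ (lengths (x , [ isRep ])))) (<⇒≤ (toℕ<n i))))

  cycle-decomposition : Conjugacy f (rotate α)
  cycle-decomposition = record
    { to       = decompose
    ; from     = recompose
    ; to∘from  = λ p → decompose-unique p _ refl
    ; from∘to  = recompose∘decompose
    ; commutes = λ u → decompose-unique (rotate α (decompose u)) (f u)
        (trans (iter-sucMod f (proj₁ (proj₂ (lengths (cycleOf u)))) (proj₂ (decompose u)))
               (cong f (recompose∘decompose u)))
    }

hang : (T : GroundedTree) {X : Set} → (X → X) → X × V (graph T) → X × V (graph T)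
hang T f (u , v) with isRoot? T v
... | yes _ = (f u , root T)
... | no  _ = (u , next (graph T) v)

hang-cycles : ∀ {X I : Set} {f : X → X} {α : I → ℕ} (T : GroundedTree) →
              Conjugacy f (rotate α) → Conjugacy (hang T f) (next (⨆ I λ c → C (α c) T))
hang-cycles {X} {I} {f} {α} T P = record
  { to       = to′
  ; from     = λ { (c , i , t) → (from P (c , i) , t) }
  ; to∘from  = λ { (c , i , t) → cong (λ p → (proj₁ p , proj₂ p , t)) (to∘from P (c , i)) }
  ; from∘to  = λ { (u , t) → cong (_, t) (from∘to P u) }
  ; commutes = commutes′
  }
  where
  to′ : X × V (graph T) → V (⨆ I λ c → C (α c) T)
  to′ (u , t) = (proj₁ (to P u) , proj₂ (to P u) , t)

  commutes′ : ∀ s → to′ (hang T f s) ≡ next (⨆ I λ c → C (α c) T) (to′ s)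
  commutes′ (u , t) with isRoot? T t
  ... | yes _ = cong (λ p → (proj₁ p , proj₂ p , root T)) (commutes P u)
  ... | no  _ = refl

opposite-≢ : (b : Fin 2) → opposite b ≢ b
opposite-≢ zero       ()
opposite-≢ (suc zero) ()

≢⇒≡opposite : {b d : Fin 2} → b ≢ d → b ≡ opposite d
≢⇒≡opposite {zero}     {zero}     b≢d = contradiction refl b≢d
≢⇒≡opposite {zero}     {suc zero} _   = refl
≢⇒≡opposite {suc zero} {zero}     _   = refl
≢⇒≡opposite {suc zero} {suc zero} b≢d = contradiction refl b≢d

module Lift {X : Set} (f f⁻¹ : X → X) (f∘f⁻¹ : ∀ x → f (f⁻¹ x) ≡ x) (f⁻¹∘f : ∀ x → f⁻¹ (f x) ≡ x)
            (c : X → Fin 2) where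

  Forest : ℕ → Set
  Forest ℓ = X × Maybe (Below 2 ℓ)

  label : ∀ {ℓ} → Forest ℓ → Fin 2
  label (u , nothing)          = c u
  -- The top vertex over u and the root over f⁻¹ u have the same successor, so their labels differ.
  label (u , just (top _))     = opposite (c (f⁻¹ u))
  label (u , just (child i _)) = i

  lift : ∀ {ℓ} → Forest (suc ℓ) → Fin 2 × Forest ℓ
  lift (u , nothing)          = (c u , f u , nothing)
  lift (u , just (top _))     = (opposite (c (f⁻¹ u)) , u , nothing)
  lift (u , just (child i v)) = (i , u , just v)

  unlift : ∀ {ℓ} → Fin 2 × Forest ℓ → Forest (suc ℓ)
  unlift (b , u , just v) = (u , just (child b v))
  unlift (b , u , nothing) with b ≟ c (f⁻¹ u)
  ... | yes _ = (f⁻¹ u , nothing)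
  ... | no  _ = (u , just (top zero))

  lift∘unlift : ∀ {ℓ} (s : Fin 2 × Forest ℓ) → lift (unlift s) ≡ s
  lift∘unlift (b , u , just v) = refl
  lift∘unlift (b , u , nothing) with b ≟ c (f⁻¹ u)
  ... | yes b≡c = cong₂ (λ b′ u′ → (b′ , u′ , nothing)) (sym b≡c) (f∘f⁻¹ u)
  ... | no  b≢c = cong (λ b′ → (b′ , u , nothing)) (sym (≢⇒≡opposite b≢c))

  unlift∘lift : ∀ {ℓ} (s : Forest (suc ℓ)) → unlift (lift s) ≡ s
  unlift∘lift (u , nothing) with c u ≟ c (f⁻¹ (f u))
  ... | yes _   = cong (_, nothing) (f⁻¹∘f u)
  ... | no  c≢c = contradiction (cong c (sym (f⁻¹∘f u))) c≢c
  unlift∘lift (u , just (top zero)) with opposite (c (f⁻¹ u)) ≟ c (f⁻¹ u)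
  ... | yes e = contradiction e (opposite-≢ _)
  ... | no  _ = refl
  unlift∘lift (u , just (child i v)) = refl

  lift-commutes : ∀ {ℓ} (s : Forest (suc ℓ)) →
                  lift (hang (Tree 2 (suc ℓ)) f s) ≡ skew label (hang (Tree 2 ℓ) f) (lift s)
  lift-commutes (u , nothing)                   = refl
  lift-commutes (u , just (top _))              = refl
  lift-commutes (u , just (child i (top _)))    = refl
  lift-commutes (u , just (child i (child j w))) = refl

  lift-relabels : ∀ {ℓ} (s : Forest (suc ℓ)) → proj₁ (lift s) ≡ label s
  lift-relabels (u , nothing)          = refl
  lift-relabels (u , just (top _))     = refl
  lift-relabels (u , just (child i v)) = refl

  lifting : ∀ ℓ → LabelledConjugacy (hang (Tree 2 (suc ℓ)) f) label
                                    (skew label (hang (Tree 2 ℓ) f)) proj₁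
  lifting ℓ = record
    { conjugacy = record
      { to = lift ; from = unlift ; to∘from = lift∘unlift ; from∘to = unlift∘lift ; commutes = lift-commutes }
    ; relabels  = lift-relabels
    }

carry : (m : ℕ) → Fin m → Fin 2
carry m z with m ≤? 2 * toℕ z
... | yes _ = suc zero
... | no  _ = zero

toℕ-dbl : ∀ {n} (x : Fin (suc n)) → toℕ (dbl (suc n) x) ≡ 2 * toℕ x % suc n
toℕ-dbl x = toℕ-fromℕ< _

dbl-carry : ∀ {m} (x : Fin m) → toℕ (carry m x) * m + toℕ (dbl m x) ≡ 2 * toℕ x
dbl-carry {suc n} x with suc n ≤? 2 * toℕ x
... | no  m≰2x = trans (toℕ-dbl x) (m<n⇒m%n≡m (≰⇒> m≰2x))
... | yes m≤2x = begin
    (suc n + 0) + toℕ (dbl (suc n) x) ≡⟨ cong₂ _+_ (+-identityʳ (suc n)) (toℕ-dbl x) ⟩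
    suc n + 2 * toℕ x % suc n         ≡⟨ cong (suc n +_) (sym (m≤n⇒[n∸m]%m≡n%m m≤2x)) ⟩
    suc n + (2 * toℕ x ∸ suc n) % suc n ≡⟨ cong (suc n +_) (m<n⇒m%n≡m 2x-m<m) ⟩
    suc n + (2 * toℕ x ∸ suc n)       ≡⟨ m+[n∸m]≡n m≤2x ⟩
    2 * toℕ x                         ∎
  where
  open ≡-Reasoning
  2x-m<m : 2 * toℕ x ∸ suc n < suc n
  2x-m<m = subst (2 * toℕ x ∸ suc n <_) (trans (m+n∸m≡n (suc n) (suc n + 0)) (+-identityʳ (suc n)))
             (∸-monoˡ-< (*-monoʳ-< 2 (toℕ<n x)) m≤2x)

odd-gap : ∀ {m a b} → ¬ 2 ∣ m → 1 * m + 2 * a ≢ 2 * b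
odd-gap {m} {a} {b} odd e = odd (subst (2 ∣_) (*-identityˡ m)
  (∣m+n∣m⇒∣n (subst (2 ∣_) (trans (sym e) (+-comm (1 * m) (2 * a))) (m∣m*n b)) (m∣m*n a)))

halves-equal : ∀ {m a b d} → ¬ 2 ∣ m → (k l : Fin 2) →
               toℕ k * m + d ≡ 2 * a → toℕ l * m + d ≡ 2 * b → a ≡ b
halves-equal {a = a} {b} odd zero       zero       e₁ e₂ = *-cancelˡ-≡ a b 2 (trans (sym e₁) e₂)
halves-equal {a = a} {b} odd (suc zero) (suc zero) e₁ e₂ = *-cancelˡ-≡ a b 2 (trans (sym e₁) e₂)
halves-equal {m} {a} {b} odd zero (suc zero) e₁ e₂ =
  contradiction (subst (λ d → 1 * m + d ≡ 2 * b) e₁ e₂) (odd-gap {m} {a} {b} odd)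
halves-equal {m} {a} {b} odd (suc zero) zero e₁ e₂ =
  contradiction (subst (λ d → 1 * m + d ≡ 2 * a) e₂ e₁) (odd-gap {m} {b} {a} odd)

dbl-injective : ∀ {m} → ¬ 2 ∣ m → ∀ {x y : Fin m} → dbl m x ≡ dbl m y → x ≡ y
dbl-injective {m} odd {x} {y} e = toℕ-injective (halves-equal odd (carry m x) (carry m y) (dbl-carry x)
  (subst (λ z → toℕ (carry m y) * m + toℕ z ≡ 2 * toℕ y) (sym e) (dbl-carry y)))

double-combine : ∀ {m} (b : Fin 2) (z : Fin m) → 2 * toℕ (combine b z) ≡ 2 * toℕ z + toℕ b * (2 * m)
double-combine {m} b z = trans (cong (2 *_) (toℕ-combine b z))
  (solve 3 (λ m b z → con 2 :* (m :* b :+ z) := con 2 :* z :+ b :* (con 2 :* m)) refl m (toℕ b) (toℕ z))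
  where open +-*-Solver

toℕ-dbl-combine : ∀ {n} (b : Fin 2) (z : Fin (suc n)) → toℕ (dbl (2 * suc n) (combine b z)) ≡ 2 * toℕ z
toℕ-dbl-combine {n} b z = begin
  toℕ (dbl (2 * suc n) (combine b z))             ≡⟨ toℕ-dbl (combine b z) ⟩
  2 * toℕ (combine b z) % (2 * suc n)             ≡⟨ cong (_% (2 * suc n)) (double-combine b z) ⟩
  (2 * toℕ z + toℕ b * (2 * suc n)) % (2 * suc n) ≡⟨ [m+kn]%n≡m%n (2 * toℕ z) (toℕ b) (2 * suc n) ⟩
  2 * toℕ z % (2 * suc n)                         ≡⟨ m<n⇒m%n≡m (*-monoʳ-< 2 (toℕ<n z)) ⟩
  2 * toℕ z                                       ∎
  where open ≡-Reasoning

combine-commutes : ∀ {m} (b : Fin 2) (z : Fin m) → combine (carry m z) (dbl m z) ≡ dbl (2 * m) (combine b z)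
combine-commutes {m@(suc _)} b z = toℕ-injective (begin
  toℕ (combine (carry m z) (dbl m z))      ≡⟨ toℕ-combine (carry m z) (dbl m z) ⟩
  m * toℕ (carry m z) + toℕ (dbl m z)     ≡⟨ cong (_+ toℕ (dbl m z)) (*-comm m (toℕ (carry m z))) ⟩
  toℕ (carry m z) * m + toℕ (dbl m z)     ≡⟨ dbl-carry z ⟩
  2 * toℕ z                               ≡⟨ sym (toℕ-dbl-combine b z) ⟩
  toℕ (dbl (2 * m) (combine b z))          ∎)
  where open ≡-Reasoning

carry-combine : ∀ {m} (b : Fin 2) (z : Fin m) → carry (2 * m) (combine b z) ≡ b
carry-combine {m@(suc _)} b z = toℕ-injective (*-cancelʳ-≡ _ _ (2 * m) (+-cancelʳ-≡ (2 * toℕ z) _ _ (begin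
  k * (2 * m) + 2 * toℕ z           ≡⟨ cong (k * (2 * m) +_) (sym (toℕ-dbl-combine b z)) ⟩
  k * (2 * m) + toℕ (dbl (2 * m) w) ≡⟨ dbl-carry w ⟩
  2 * toℕ w                         ≡⟨ double-combine b z ⟩
  2 * toℕ z + toℕ b * (2 * m)       ≡⟨ +-comm (2 * toℕ z) _ ⟩
  toℕ b * (2 * m) + 2 * toℕ z       ∎)))
  where
  open ≡-Reasoning
  w = combine b z
  k = toℕ (carry (2 * m) w)

doubling : ∀ m → LabelledConjugacy (skew (carry m) (dbl m)) proj₁ (dbl (2 * m)) (carry (2 * m))
doubling m = record
  { conjugacy = record
    { to       = uncurry combine
    ; from     = remQuot m
    ; to∘from  = combine-remQuot {2} m
    ; from∘to  = λ { (b , z) → remQuot-combine b z }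
    ; commutes = λ { (b , z) → combine-commutes b z }
    }
  ; relabels  = λ { (b , z) → carry-combine b z }
  }

module Tower {μ : ℕ} (odd : ¬ 2 ∣ μ) where

  open Permutation (dbl μ) (dbl-injective odd) using (f⁻¹; f∘f⁻¹; f⁻¹∘f)
  open Lift (dbl μ) f⁻¹ f∘f⁻¹ f⁻¹∘f (carry μ)

  Encodes : ℕ → ℕ → Set
  Encodes ℓ m = LabelledConjugacy (hang (Tree 2 ℓ) (dbl μ)) label (dbl m) (carry m)

  encodes-base : Encodes 0 μ
  encodes-base = record
    { conjugacy = record
      { to       = λ { (u , nothing) → u }
      ; from     = λ u → (u , nothing)
      ; to∘from  = λ _ → refl
      ; from∘to  = λ { (u , nothing) → refl }
      ; commutes = λ { (u , nothing) → refl }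
      }
    ; relabels  = λ { (u , nothing) → refl }
    }

  encodes-step : ∀ {ℓ m} → Encodes ℓ m → Encodes (suc ℓ) (2 * m)
  encodes-step {ℓ} {m} E = lconj-trans (lifting ℓ) (lconj-trans (skew-cong E) (doubling m))

  tower : ∀ ℓ → Encodes ℓ (2 ^ ℓ * μ)
  tower zero    = subst (Encodes 0) (sym (*-identityˡ μ)) encodes-base
  tower (suc ℓ) = subst (Encodes (suc ℓ)) (sym (*-assoc 2 (2 ^ ℓ) μ)) (encodes-step (tower ℓ))

mainTheorem6 : (θ μ : ℕ) → ¬ (2 ∣ μ) →
    (α : Cycle (dbl μ) → ℕ) →
    (∀ c → IsLength (dbl μ) (proj₁ c) (α c)) →
    A (2 ^ θ * μ) ≅ ⨆ (Cycle (dbl μ)) (λ c → C (α c) (Tree 2 θ))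
mainTheorem6 θ μ odd α lengths =
  conjugacy⇒≅ (conj-trans (conj-sym (conjugacy (tower θ))) (hang-cycles (Tree 2 θ) cycle-decomposition))
  where
  open Tower odd
  open CycleDecomposition (dbl μ) (dbl-injective odd) α lengths
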